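{- Let $k$ be a positive integer, $r>0$, and $m$ a positive integer divisible by $4^{k-1}$, and let $X = A_1 \cup \dots \cup A_k \subset \mathbb{R}^2$ be the dataset described in the context. Let $\alpha$ be a real number and let $C$ denote the set of $k$ centers chosen by the k-means++ seeding algorithm on $X$. If $C$ covers at most $\alpha k$ of the clusters $A_1,\dots,A_k$, then \[ \frac{\phi_C(X)}{\phi_{OPT}(X)} \geq \frac{9-\alpha}{8}. \]
   Context: Dataset: for $i = 1, \dots, k$, the cluster $A_i$ consists of $m/4^{i-1}$ copies of the point $((2^i - 2)r,\ 2^{i-2} r)$ and $m/4^{i-1}$ copies of the point $((2^i-2)r,\ -2^{i-2}r)$, and $X$ is the multiset union of the $A_i$. $D(x,c)$ is the squared Euclidean distance, $\phi_C(Y) = \sum_{y \in Y} \min_{c \in C} D(y,c)$ (multiplicities counted), and $\phi_{OPT}(X)$ is the minimum of $\phi_C(X)$ over all $k$-element sets of centers $C \subseteq X$ (discrete k-means). A set of centers $C$ covers $A_j$ if $C$ contains a point of $A_j$. The k-means++ seeding algorithm chooses $k$ centers from $X$: $c_1$ uniformly at random from $X$ (copies counted separately); for $i>1$, each $x \in X$ is chosen as $c_i$ with probability $\min_{c \in \{c_1,\dots,c_{i-1}\}} D(x,c) / \phi_{\{c_1,\dots,c_{i-1}\}}(X)$.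
   Formalization: The parameters r and α are rational rather than real, so the dataset X lies in ℚ². -}

module Defs where

open import Data.Bool using (Bool; true; false; if_then_else_)
open import Data.Nat as ℕ using (ℕ; zero; suc; _^_; _∸_)
open import Data.Nat.DivMod as ND using ()
open import Data.Nat.Properties using (m^n≢0)
open import Data.Integer using (+_)
open import Data.Rational using (ℚ; 0ℚ; _+_; _-_; _*_; _<_; _≤_; _≟_)
import Data.Rational as Q
open import Data.Fin using (Fin; toℕ)
import Data.List
open import Data.List using (List; []; _∷_; [_]; replicate; concatMap; allFin; foldr; length; filter)
open import Data.List.Membership.Propositional using (_∈_)
open import Data.List.Relation.Unary.Any using (Any; any?)
open import Data.Product using (_×_; _,_; proj₁; proj₂; Σ; ∃)
open import Data.Product.Properties using (≡-dec)
open import Data.List.Relation.Unary.Unique.Propositional using (Unique)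
open import Relation.Binary.PropositionalEquality using (_≡_)
open import Relation.Nullary using (Dec)
open import Relation.Binary.Definitions using (DecidableEquality)

ℕtoℚ : ℕ → ℚ
ℕtoℚ n = (+ n) Q./ 1

Point : Set
Point = ℚ × ℚ

_≟P_ : DecidableEquality Point
_≟P_ = ≡-dec _≟_ _≟_

D : Point → Point → ℚ
D (x₁ , y₁) (x₂ , y₂) = (x₁ - x₂) * (x₁ - x₂) + (y₁ - y₂) * (y₁ - y₂)

-- minimum of a list of rationals (the empty list gets 0; only used for
-- nonempty lists below)
minList : List ℚ → ℚ
minList [] = 0ℚ
minList (q ∷ []) = q
minList (q ∷ qs@(_ ∷ _)) = Q._⊓_ q (minList qs)

dist : Point → List Point → ℚ
dist x C = minList (Data.List.map (D x) C)

φ : List Point → List Point → ℚ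
φ C Y = foldr (λ y acc → dist y C + acc) 0ℚ Y

-- Cluster A_i for i = j+1, j : Fin k (0-based index j).
-- The two points ((2^i - 2) r, ± 2^(i-2) r), with 2^(i-2) = 2^i / 4.
pt⁺ pt⁻ : ℚ → ℕ → Point
pt⁺ r i = (ℕtoℚ (2 ^ i ∸ 2) * r , ((+ (2 ^ i)) Q./ 4) * r)
pt⁻ r i = (ℕtoℚ (2 ^ i ∸ 2) * r , Q.- (((+ (2 ^ i)) Q./ 4) * r))

-- number of copies of each point in A_i : m / 4^(i-1) = m / 4^j
copies : ℕ → ℕ → ℕ
copies m j = ND._/_ m (4 ^ j) {{m^n≢0 4 j}}

A : ℚ → ℕ → ℕ → List Point
A r m j = replicate (copies m j) (pt⁺ r (suc j)) Data.List.++ replicate (copies m j) (pt⁻ r (suc j))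

X : ℕ → ℚ → ℕ → List Point
X k r m = concatMap (λ (j : Fin k) → A r m (toℕ j)) (allFin k)

covers? : (C Y : List Point) → Dec (Any (λ c → c ∈ Y) C)
covers? C Y = any? (λ c → c ∈? Y) C
  where open import Data.List.Membership.DecPropositional _≟P_ using (_∈?_)

numCovered : ℕ → ℚ → ℕ → List Point → ℕ
numCovered k r m C = length (filter (λ (j : Fin k) → covers? C (A r m (toℕ j))) (allFin k))

-- Possible outcomes (positive-probability runs) of k-means++ seeding on Y.
-- The list is stored most-recent-first.  c₁ is any point of Y (probability
-- 1/|Y| > 0); a next center x has probability dist x C / φ_C(Y), which is
-- positive iff dist x C > 0.
data KMPP (Y : List Point) : List Point → Set where
  first : ∀ {x} → x ∈ Y → KMPP Y [ x ]
  next  : ∀ {C x} → KMPP Y C → x ∈ Y → 0ℚ < dist x C → KMPP Y (x ∷ C)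

IsCenterSet : ℕ → List Point → List Point → Set
IsCenterSet k Y C = Unique C × (∀ {c} → c ∈ C → c ∈ Y) × length C ≡ k

IsOPT : ℕ → List Point → ℚ → Set
IsOPT k Y v = (Σ (List Point) λ C → IsCenterSet k Y C × φ C Y ≡ v)
            × (∀ C → IsCenterSet k Y C → v ≤ φ C Y)

{-# OPTIONS --safe #-}
module Submission where

-- Write M = m r² and δ_j = 4^j r² for the squared distance between the two
-- points of A_{j+1}.  Each point of A_{j+1} is repeated m / 4^j times, so a
-- point of A_{j+1} that is not a centre costs at least M in total, and
-- because the clusters' x-coordinates grow geometrically it costs at least
-- (17/16) M if its whole cluster is uncovered.  Hence every cluster satisfies
--   17 M ≤ 8 φ_C(A_j) + M (8 b_j + [C covers A_j]),
-- where b_j ≤ 2 counts the points of A_j chosen as centres.  The points are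
-- pairwise distinct, so Σ b_j ≤ |C| = k, and summing gives
-- (9k − #covered) M ≤ 8 φ_C(X).  The upper points of all clusters show
-- φ_OPT(X) ≤ k M, which yields the bound.

open import Defs
open import Data.Nat using (ℕ; _≥_; _^_; _∸_)
open import Data.Nat.Divisibility using (_∣_)
open import Data.Rational using (ℚ; 0ℚ; _<_; _≤_; _*_; _-_)
open import Data.List using (List; length)
open import Relation.Binary.PropositionalEquality using (_≡_)

open import Data.Bool as Bool using (Bool; true; false; not; if_then_else_)
open import Data.Bool.Properties using (¬-not)
open import Data.Empty using (⊥-elim)
open import Data.Fin using (Fin; toℕ)
import Data.Fin.Properties as Fin
import Data.Integer as ℤ
import Data.Integer.Properties as ℤ
open import Data.List using ([]; _∷_; _++_; replicate; foldr; map; concatMap; cartesianProductWith; filter; allFin)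
import Data.List.Properties as List
open import Data.List.Membership.Propositional using (_∈_; lose)
open import Data.List.Membership.Propositional.Properties
  using (∈-map⁺; ∈-map⁻; ∈-++⁻; ∈-++⁺ˡ; ∈-++⁺ʳ; ∈-concatMap⁻; ∈-concatMap⁺; ∈-allFin)
open import Data.List.Relation.Unary.All as All using (All; []; _∷_)
open import Data.List.Relation.Unary.AllPairs using ([]; _∷_)
open import Data.List.Relation.Unary.Any using (Any; here; there; satisfied)
open import Data.List.Relation.Unary.Unique.Propositional using (Unique)
import Data.List.Relation.Unary.Unique.Propositional.Properties as Unique
open import Data.Nat as ℕ using (zero; suc)
import Data.Nat.Coprimality as Coprime
import Data.Nat.Divisibility as ∣
import Data.Nat.DivMod as DivMod
import Data.Nat.Properties as ℕ
open import Data.Nat.Tactic.RingSolver using (solve-∀)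
open import Data.Product using (_×_; _,_; proj₁; proj₂; ∃-syntax)
open import Data.Product.Properties using (≡-dec)
open import Data.Rational using (1ℚ; _+_; -_; mkℚ; _/_; toℚᵘ; Positive; nonNegative; nonPositive; positive)
import Data.Rational.Properties as ℚ
open import Data.Rational.Solver using (module +-*-Solver)
open +-*-Solver using (solve; _:=_; _:+_; _:*_; _:-_; :-_; con; Polynomial)
import Data.Rational.Unnormalised as ℚᵘ
import Data.Rational.Unnormalised.Properties as ℚᵘ
open import Data.Sum using (_⊎_; inj₁; inj₂; [_,_]′)
open import Function using (id)
open import Relation.Binary using (DecidableEquality; tri<; tri≈; tri>)
open import Relation.Binary.PropositionalEquality using (refl; trans; cong; cong₂; _≢_; module ≡-Reasoning)
import Relation.Binary.PropositionalEquality as ≡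
open import Relation.Nullary using (¬_; Dec; yes; no; does)
open import Relation.Unary using (Decidable)

p≤p+q : ∀ {p q} → 0ℚ ≤ q → p ≤ p + q
p≤p+q {p} {q} 0≤q = ℚ.≤-trans (ℚ.≤-reflexive (≡.sym (ℚ.+-identityʳ p))) (ℚ.+-monoʳ-≤ p 0≤q)

p≤q⇒0≤q-p : ∀ {p q} → p ≤ q → 0ℚ ≤ q - p
p≤q⇒0≤q-p {p} {q} p≤q = ℚ.≤-trans (ℚ.≤-reflexive (≡.sym (ℚ.+-inverseʳ p))) (ℚ.+-monoˡ-≤ (- p) p≤q)

+-cancelʳ-≤ : ∀ {p q} r → p + r ≤ q + r → p ≤ q
+-cancelʳ-≤ {p} {q} r p+r≤q+r = begin
  p            ≡⟨ solve 2 (λ p r → p := p :+ r :- r) refl p r ⟩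
  p + r - r    ≤⟨ ℚ.+-monoˡ-≤ (- r) p+r≤q+r ⟩
  q + r - r    ≡⟨ solve 2 (λ q r → q :+ r :- r := q) refl q r ⟩
  q            ∎
  where open ℚ.≤-Reasoning

*-nonNeg : ∀ {p q} → 0ℚ ≤ p → 0ℚ ≤ q → 0ℚ ≤ p * q
*-nonNeg {p} {q} 0≤p 0≤q = ℚ.nonNegative⁻¹ (p * q) {{ℚ.nonNeg*nonNeg⇒nonNeg p {{nonNegative 0≤p}} q {{nonNegative 0≤q}}}}

0≤p*p : ∀ p → 0ℚ ≤ p * p
0≤p*p p with ℚ.≤-total 0ℚ p
... | inj₁ 0≤p = *-nonNeg 0≤p 0≤p
... | inj₂ p≤0 = ℚ.nonNegative⁻¹ (p * p) {{ℚ.nonPos*nonPos⇒nonPos p {{nonPositive p≤0}} p {{nonPositive p≤0}}}}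

p≤q⇒p*p≤q*q : ∀ {p q} → 0ℚ ≤ p → p ≤ q → p * p ≤ q * q
p≤q⇒p*p≤q*q {p} {q} 0≤p p≤q = ℚ.≤-trans
  (ℚ.*-monoˡ-≤-nonNeg p {{nonNegative 0≤p}} p≤q)
  (ℚ.*-monoʳ-≤-nonNeg q {{nonNegative (ℚ.≤-trans 0≤p p≤q)}} p≤q)

-- The sum 1ℚ + mkℚ (+ n) 0 _ unfolds to (1·1 + n·1) / (1·1), which agrees
-- with (+ suc n) / 1 up to the numerator identity n·1 = n.
ℕtoℚ-suc : ∀ n → ℕtoℚ (suc n) ≡ 1ℚ + ℕtoℚ n
ℕtoℚ-suc n = ≡.sym (begin
  1ℚ + ℕtoℚ n              ≡⟨ cong (1ℚ +_) (ℚ.normalize-coprime n⊥1) ⟩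
  1ℚ + mkℚ (ℤ.+ n) 0 n⊥1   ≡⟨ ℚ./-cong {ℤ.+ 1 ℤ.* ℤ.+ 1 ℤ.+ ℤ.+ n ℤ.* ℤ.+ 1} {1} (cong (ℤ._+_ (ℤ.+ 1)) (ℤ.*-identityʳ (ℤ.+ n))) refl ⟩
  ℕtoℚ (suc n)             ∎)
  where
  open ≡-Reasoning
  n⊥1 = Coprime.sym (Coprime.1-coprimeTo n)

ℕtoℚ-suc-* : ∀ n p → p + ℕtoℚ n * p ≡ ℕtoℚ (suc n) * p
ℕtoℚ-suc-* n p = trans (solve 2 (λ p n → p :+ n :* p := (con 1ℚ :+ n) :* p) refl p (ℕtoℚ n)) (cong (_* p) (≡.sym (ℕtoℚ-suc n)))

ℕtoℚ-+ : ∀ m n → ℕtoℚ (m ℕ.+ n) ≡ ℕtoℚ m + ℕtoℚ n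
ℕtoℚ-+ zero    n = ≡.sym (ℚ.+-identityˡ (ℕtoℚ n))
ℕtoℚ-+ (suc m) n = begin
  ℕtoℚ (suc (m ℕ.+ n))         ≡⟨ ℕtoℚ-suc (m ℕ.+ n) ⟩
  1ℚ + ℕtoℚ (m ℕ.+ n)          ≡⟨ cong (1ℚ +_) (ℕtoℚ-+ m n) ⟩
  1ℚ + (ℕtoℚ m + ℕtoℚ n)       ≡⟨ ℚ.+-assoc 1ℚ (ℕtoℚ m) (ℕtoℚ n) ⟨
  1ℚ + ℕtoℚ m + ℕtoℚ n         ≡⟨ cong (_+ ℕtoℚ n) (ℕtoℚ-suc m) ⟨
  ℕtoℚ (suc m) + ℕtoℚ n        ∎
  where open ≡-Reasoning

ℕtoℚ-* : ∀ m n → ℕtoℚ (m ℕ.* n) ≡ ℕtoℚ m * ℕtoℚ n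
ℕtoℚ-* zero    n = ≡.sym (ℚ.*-zeroˡ (ℕtoℚ n))
ℕtoℚ-* (suc m) n = begin
  ℕtoℚ (n ℕ.+ m ℕ.* n)         ≡⟨ ℕtoℚ-+ n (m ℕ.* n) ⟩
  ℕtoℚ n + ℕtoℚ (m ℕ.* n)      ≡⟨ cong (ℕtoℚ n +_) (ℕtoℚ-* m n) ⟩
  ℕtoℚ n + ℕtoℚ m * ℕtoℚ n     ≡⟨ ℕtoℚ-suc-* m (ℕtoℚ n) ⟩
  ℕtoℚ (suc m) * ℕtoℚ n        ∎
  where open ≡-Reasoning

ℕtoℚ-∸ : ∀ {m n} → n ℕ.≤ m → ℕtoℚ (m ∸ n) ≡ ℕtoℚ m - ℕtoℚ n
ℕtoℚ-∸ {m} {n} n≤m = begin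
  ℕtoℚ (m ∸ n)                     ≡⟨ solve 2 (λ d y → d := (y :+ d) :- y) refl (ℕtoℚ (m ∸ n)) (ℕtoℚ n) ⟩
  (ℕtoℚ n + ℕtoℚ (m ∸ n)) - ℕtoℚ n ≡⟨ cong (_- ℕtoℚ n) (ℕtoℚ-+ n (m ∸ n)) ⟨
  ℕtoℚ (n ℕ.+ (m ∸ n)) - ℕtoℚ n    ≡⟨ cong (λ z → ℕtoℚ z - ℕtoℚ n) (ℕ.m+[n∸m]≡n n≤m) ⟩
  ℕtoℚ m - ℕtoℚ n                  ∎
  where open ≡-Reasoning

ℕtoℚ-nonNeg : ∀ n → 0ℚ ≤ ℕtoℚ n
ℕtoℚ-nonNeg n = ℚ.nonNegative⁻¹ (ℕtoℚ n) {{ℚ.normalize-nonNeg n 1}}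

ℕtoℚ-mono-≤ : ∀ {m n} → m ℕ.≤ n → ℕtoℚ m ≤ ℕtoℚ n
ℕtoℚ-mono-≤ {m} {n} m≤n = begin
  ℕtoℚ m                     ≤⟨ p≤p+q (ℕtoℚ-nonNeg (n ∸ m)) ⟩
  ℕtoℚ m + ℕtoℚ (n ∸ m)      ≡⟨ ℕtoℚ-+ m (n ∸ m) ⟨
  ℕtoℚ (m ℕ.+ (n ∸ m))       ≡⟨ cong ℕtoℚ (ℕ.m+[n∸m]≡n m≤n) ⟩
  ℕtoℚ n                     ∎
  where open ℚ.≤-Reasoning

-- Both (+ n) / suc d and ℕtoℚ n are by definition fromℚᵘ of the evident
-- unnormalised fractions, so the identity is checked in ℚᵘ.
ℕtoℚ-/ : ∀ n d → ℤ.+ n / suc d ≡ ℕtoℚ n * (ℤ.+ 1 / suc d)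
ℕtoℚ-/ n d = ℚ.toℚᵘ-injective (begin
  toℚᵘ (ℤ.+ n / suc d)                           ≈⟨ ℚ.toℚᵘ-fromℚᵘ (ℚᵘ.mkℚᵘ (ℤ.+ n) d) ⟩
  ℚᵘ.mkℚᵘ (ℤ.+ n) d                              ≈⟨ ℚᵘ.*≡* eq ⟩
  ℚᵘ.mkℚᵘ (ℤ.+ n) 0 ℚᵘ.* ℚᵘ.mkℚᵘ (ℤ.+ 1) d       ≈⟨ ℚᵘ.*-cong (ℚ.toℚᵘ-fromℚᵘ (ℚᵘ.mkℚᵘ (ℤ.+ n) 0)) (ℚ.toℚᵘ-fromℚᵘ (ℚᵘ.mkℚᵘ (ℤ.+ 1) d)) ⟨
  toℚᵘ (ℕtoℚ n) ℚᵘ.* toℚᵘ (ℤ.+ 1 / suc d)        ≈⟨ ℚ.toℚᵘ-homo-* (ℕtoℚ n) (ℤ.+ 1 / suc d) ⟨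
  toℚᵘ (ℕtoℚ n * (ℤ.+ 1 / suc d))                ∎)
  where
  open ℚᵘ.≃-Reasoning
  eq : ℤ.+ n ℤ.* ℤ.+ (1 ℕ.* suc d) ≡ (ℤ.+ n ℤ.* ℤ.+ 1) ℤ.* ℤ.+ suc d
  eq = cong₂ ℤ._*_ (≡.sym (ℤ.*-identityʳ (ℤ.+ n))) (cong ℤ.+_ (ℕ.*-identityˡ (suc d)))

4^≡2^*2^ : ∀ j → 4 ^ j ≡ 2 ^ j ℕ.* 2 ^ j
4^≡2^*2^ zero    = refl
4^≡2^*2^ (suc j) = trans (cong (4 ℕ.*_) (4^≡2^*2^ j)) (4[x*x]≡2x*2x (2 ^ j))
  where
  4[x*x]≡2x*2x : ∀ x → 4 ℕ.* (x ℕ.* x) ≡ 2 ℕ.* x ℕ.* (2 ℕ.* x)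
  4[x*x]≡2x*2x = solve-∀

powers-of-2-separated : ∀ {j j'} → j ≢ j' → 2 ℕ.* 2 ^ j ℕ.≤ 2 ^ j' ⊎ 2 ℕ.* 2 ^ j' ℕ.≤ 2 ^ j
powers-of-2-separated {j} {j'} j≢j' with ℕ.<-cmp j j'
... | tri< j<j' _ _ = inj₁ (ℕ.^-monoʳ-≤ 2 j<j')
... | tri≈ _ j≡j' _ = ⊥-elim (j≢j' j≡j')
... | tri> _ _ j'<j = inj₂ (ℕ.^-monoʳ-≤ 2 j'<j)

^-monoʳ-∣ : ∀ b {i j} → i ℕ.≤ j → b ^ i ∣ b ^ j
^-monoʳ-∣ b {i} {j} i≤j = ≡.subst (λ n → b ^ i ∣ b ^ n) (ℕ.m+[n∸m]≡n i≤j)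
  (≡.subst (b ^ i ∣_) (≡.sym (ℕ.^-distribˡ-+-* b i (j ∸ i))) (∣.m∣m*n (b ^ (j ∸ i))))

∈-replicate⁻ : ∀ {A : Set} {n} {x y : A} → y ∈ replicate n x → y ≡ x
∈-replicate⁻ {n = suc n} (here y≡x)  = y≡x
∈-replicate⁻ {n = suc n} (there y∈) = ∈-replicate⁻ y∈

∈-replicate⁺ : ∀ {A : Set} {n} {x : A} → 1 ℕ.≤ n → x ∈ replicate n x
∈-replicate⁺ {n = suc n} _ = here refl

-- φ C Y is by definition ∑ (λ y → dist y C) Y.
∑ : {A : Set} → (A → ℚ) → List A → ℚ
∑ f = foldr (λ x acc → f x + acc) 0ℚ

module _ {A : Set} where

  ∑-++ : ∀ (f : A → ℚ) xs ys → ∑ f (xs ++ ys) ≡ ∑ f xs + ∑ f ys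
  ∑-++ f []       ys = ≡.sym (ℚ.+-identityˡ (∑ f ys))
  ∑-++ f (x ∷ xs) ys = trans (cong (f x +_) (∑-++ f xs ys)) (≡.sym (ℚ.+-assoc (f x) (∑ f xs) (∑ f ys)))

  ∑-replicate : ∀ (f : A → ℚ) n x → ∑ f (replicate n x) ≡ ℕtoℚ n * f x
  ∑-replicate f zero    x = ≡.sym (ℚ.*-zeroˡ (f x))
  ∑-replicate f (suc n) x = trans (cong (f x +_) (∑-replicate f n x)) (ℕtoℚ-suc-* n (f x))

  ∑-const : ∀ c (xs : List A) → ∑ (λ _ → c) xs ≡ ℕtoℚ (length xs) * c
  ∑-const c []       = ≡.sym (ℚ.*-zeroˡ c)
  ∑-const c (x ∷ xs) = trans (cong (c +_) (∑-const c xs)) (ℕtoℚ-suc-* (length xs) c)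

  ∑-concatMap : ∀ {B : Set} (f : A → ℚ) (g : B → List A) ys → ∑ f (concatMap g ys) ≡ ∑ (λ y → ∑ f (g y)) ys
  ∑-concatMap f g []       = refl
  ∑-concatMap f g (y ∷ ys) = trans (∑-++ f (g y) (concatMap g ys)) (cong (∑ f (g y) +_) (∑-concatMap f g ys))

  ∑-cartesianProductWith : ∀ {B E : Set} (f : A → ℚ) (g : B → E → A) xs ys →
    ∑ f (cartesianProductWith g xs ys) ≡ ∑ (λ x → ∑ f (map (g x) ys)) xs
  ∑-cartesianProductWith f g []       ys = refl
  ∑-cartesianProductWith f g (x ∷ xs) ys =
    trans (∑-++ f (map (g x) ys) (cartesianProductWith g xs ys)) (cong (∑ f (map (g x) ys) +_) (∑-cartesianProductWith f g xs ys))

  ∑-mono-≤ : ∀ {f g : A → ℚ} → (∀ x → f x ≤ g x) → ∀ xs → ∑ f xs ≤ ∑ g xs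
  ∑-mono-≤ f≤g []       = ℚ.≤-refl
  ∑-mono-≤ f≤g (x ∷ xs) = ℚ.+-mono-≤ (f≤g x) (∑-mono-≤ f≤g xs)

  ∑-nonNeg : ∀ {f : A → ℚ} → (∀ x → 0ℚ ≤ f x) → ∀ xs → 0ℚ ≤ ∑ f xs
  ∑-nonNeg 0≤f []       = ℚ.≤-refl
  ∑-nonNeg 0≤f (x ∷ xs) = ℚ.+-mono-≤ (0≤f x) (∑-nonNeg 0≤f xs)

  ∑-+ : ∀ (f g : A → ℚ) xs → ∑ (λ x → f x + g x) xs ≡ ∑ f xs + ∑ g xs
  ∑-+ f g []       = refl
  ∑-+ f g (x ∷ xs) = trans (cong (f x + g x +_) (∑-+ f g xs))
    (solve 4 (λ a b c d → (a :+ b) :+ (c :+ d) := (a :+ c) :+ (b :+ d)) refl (f x) (g x) (∑ f xs) (∑ g xs))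

  ∑-*ˡ : ∀ c (f : A → ℚ) xs → ∑ (λ x → c * f x) xs ≡ c * ∑ f xs
  ∑-*ˡ c f []       = ≡.sym (ℚ.*-zeroʳ c)
  ∑-*ˡ c f (x ∷ xs) = trans (cong (c * f x +_) (∑-*ˡ c f xs)) (≡.sym (ℚ.*-distribˡ-+ c (f x) (∑ f xs)))

∑-allFin-const : ∀ k c → ∑ (λ _ → c) (allFin k) ≡ ℕtoℚ k * c
∑-allFin-const k c = trans (∑-const c (allFin k)) (cong (λ n → ℕtoℚ n * c) (List.length-tabulate {n = k} id))

𝟙 : {P : Set} → Dec P → ℚ
𝟙 P? = if does P? then 1ℚ else 0ℚ

𝟙-nonNeg : ∀ {P : Set} (P? : Dec P) → 0ℚ ≤ 𝟙 P?
𝟙-nonNeg (yes _) = ℚ.nonNegative⁻¹ 1ℚ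
𝟙-nonNeg (no  _) = ℚ.≤-refl

𝟙-yes : ∀ {P : Set} → P → (P? : Dec P) → 𝟙 P? ≡ 1ℚ
𝟙-yes p (yes _) = refl
𝟙-yes p (no ¬p) = ⊥-elim (¬p p)

module _ {A : Set} where

  length-filter≡∑𝟙 : ∀ {P : A → Set} (P? : Decidable P) xs → ℕtoℚ (length (filter P? xs)) ≡ ∑ (λ x → 𝟙 (P? x)) xs
  length-filter≡∑𝟙 P? []       = refl
  length-filter≡∑𝟙 P? (x ∷ xs) with P? x
  ... | yes _ = trans (ℕtoℚ-suc (length (filter P? xs))) (cong (1ℚ +_) (length-filter≡∑𝟙 P? xs))
  ... | no  _ = trans (length-filter≡∑𝟙 P? xs) (≡.sym (ℚ.+-identityˡ _))

module _ {A : Set} (_≟_ : DecidableEquality A) where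
  open import Data.List.Membership.DecPropositional _≟_ using (_∈?_)

  ∑𝟙≟≡0 : ∀ {c} xs → All (_≢ c) xs → ∑ (λ x → 𝟙 (x ≟ c)) xs ≡ 0ℚ
  ∑𝟙≟≡0 []       []             = refl
  ∑𝟙≟≡0 {c} (x ∷ xs) (x≢c ∷ xs≢c) with x ≟ c
  ... | yes x≡c = ⊥-elim (x≢c x≡c)
  ... | no  _   = trans (ℚ.+-identityˡ _) (∑𝟙≟≡0 xs xs≢c)

  ∑𝟙≟≤1 : ∀ {c} xs → Unique xs → ∑ (λ x → 𝟙 (x ≟ c)) xs ≤ 1ℚ
  ∑𝟙≟≤1     []       []                = ℚ.nonNegative⁻¹ 1ℚ
  ∑𝟙≟≤1 {c} (x ∷ xs) (x≢xs ∷ unique) with x ≟ c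
  ... | yes refl = ℚ.≤-reflexive (trans (cong (1ℚ +_) (∑𝟙≟≡0 xs (All.map (λ x≢y y≡x → x≢y (≡.sym y≡x)) x≢xs))) (ℚ.+-identityʳ 1ℚ))
  ... | no  _    = ℚ.≤-trans (ℚ.≤-reflexive (ℚ.+-identityˡ _)) (∑𝟙≟≤1 xs unique)

  𝟙∈∷≤ : ∀ x c C → 𝟙 (x ∈? (c ∷ C)) ≤ 𝟙 (x ≟ c) + 𝟙 (x ∈? C)
  𝟙∈∷≤ x c C = bound (x ∈? (c ∷ C))
    where
    bound : (x∈?c∷C : Dec (x ∈ c ∷ C)) → 𝟙 x∈?c∷C ≤ 𝟙 (x ≟ c) + 𝟙 (x ∈? C)
    bound (no  _)           = ℚ.+-mono-≤ (𝟙-nonNeg (x ≟ c)) (𝟙-nonNeg (x ∈? C))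
    bound (yes (here x≡c))  = ℚ.≤-trans (p≤p+q (𝟙-nonNeg (x ∈? C))) (ℚ.≤-reflexive (cong (_+ 𝟙 (x ∈? C)) (≡.sym (𝟙-yes x≡c (x ≟ c)))))
    bound (yes (there x∈C)) = ℚ.≤-trans (p≤p+q (𝟙-nonNeg (x ≟ c))) (ℚ.≤-reflexive (trans (ℚ.+-comm 1ℚ (𝟙 (x ≟ c))) (cong (𝟙 (x ≟ c) +_) (≡.sym (𝟙-yes x∈C (x ∈? C))))))

  ∑𝟙∈≤length : ∀ xs → Unique xs → ∀ C → ∑ (λ x → 𝟙 (x ∈? C)) xs ≤ ℕtoℚ (length C)
  ∑𝟙∈≤length xs unique []      = ℚ.≤-reflexive (trans (∑-const 0ℚ xs) (ℚ.*-zeroʳ (ℕtoℚ (length xs))))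
  ∑𝟙∈≤length xs unique (c ∷ C) = begin
    ∑ (λ x → 𝟙 (x ∈? (c ∷ C))) xs                     ≤⟨ ∑-mono-≤ (λ x → 𝟙∈∷≤ x c C) xs ⟩
    ∑ (λ x → 𝟙 (x ≟ c) + 𝟙 (x ∈? C)) xs               ≡⟨ ∑-+ (λ x → 𝟙 (x ≟ c)) (λ x → 𝟙 (x ∈? C)) xs ⟩
    ∑ (λ x → 𝟙 (x ≟ c)) xs + ∑ (λ x → 𝟙 (x ∈? C)) xs  ≤⟨ ℚ.+-mono-≤ (∑𝟙≟≤1 xs unique) (∑𝟙∈≤length xs unique C) ⟩
    1ℚ + ℕtoℚ (length C)                              ≡⟨ ℕtoℚ-suc (length C) ⟨
    ℕtoℚ (length (c ∷ C))                             ∎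
    where open ℚ.≤-Reasoning

minList-≤ : ∀ {q} qs → q ∈ qs → minList qs ≤ q
minList-≤ (q ∷ [])           (here refl) = ℚ.≤-refl
minList-≤ (q ∷ qs@(_ ∷ _))   (here refl) = ℚ.p⊓q≤p q (minList qs)
minList-≤ (q ∷ qs@(_ ∷ _))   (there q'∈qs) = ℚ.≤-trans (ℚ.p⊓q≤q q (minList qs)) (minList-≤ qs q'∈qs)

minList-∈ : ∀ qs → qs ≢ [] → minList qs ∈ qs
minList-∈ []                 qs≢[] = ⊥-elim (qs≢[] refl)
minList-∈ (q ∷ [])           _     = here refl
minList-∈ (q ∷ qs@(_ ∷ _))   _ =
  [ here , (λ q⊓m≡m → ≡.subst (_∈ q ∷ qs) (≡.sym q⊓m≡m) (there (minList-∈ qs (λ ())))) ]′ (ℚ.⊓-sel q (minList qs))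

dist-≤-D : ∀ x {c} C → c ∈ C → dist x C ≤ D x c
dist-≤-D x C c∈C = minList-≤ (map (D x) C) (∈-map⁺ (D x) c∈C)

dist-attained : ∀ x C → C ≢ [] → ∃[ c ] c ∈ C × dist x C ≡ D x c
dist-attained x []          C≢[] = ⊥-elim (C≢[] refl)
dist-attained x C@(_ ∷ _)   _    = ∈-map⁻ (D x) (minList-∈ (map (D x) C) (λ ()))

dist-elim : ∀ (P : ℚ → Set) x C → C ≢ [] → (∀ {c} → c ∈ C → P (D x c)) → P (dist x C)
dist-elim P x C C≢[] P[D] with dist-attained x C C≢[]
... | c , c∈C , dist≡D = ≡.subst P (≡.sym dist≡D) (P[D] c∈C)

D-nonNeg : ∀ p q → 0ℚ ≤ D p q
D-nonNeg (x , y) (x' , y') = ℚ.+-mono-≤ (0≤p*p (x - x')) (0≤p*p (y - y'))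

dist-nonNeg : ∀ x C → 0ℚ ≤ dist x C
dist-nonNeg x []          = ℚ.≤-refl
dist-nonNeg x C@(_ ∷ _)   = dist-elim (0ℚ ≤_) x C (λ ()) (λ {c} _ → D-nonNeg x c)

φ-nonNeg : ∀ C Y → 0ℚ ≤ φ C Y
φ-nonNeg C = ∑-nonNeg (λ y → dist-nonNeg y C)

D-self : ∀ p → D p p ≡ 0ℚ
D-self (x , y) = solve 2 (λ x y → (x :- x) :* (x :- x) :+ (y :- y) :* (y :- y) := con 0ℚ) refl x y

-- Geometry of the clusters

½ ¼ : ℚ
½ = ℤ.+ 1 / 2
¼ = ℤ.+ 1 / 4

signed : Bool → ℚ → ℚ
signed true  q = q
signed false q = - q

sq-sub≤sq-signed-sub : ∀ s s' {a b} → 0ℚ ≤ a → 0ℚ ≤ b →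
  (a - b) * (a - b) ≤ (signed s a - signed s' b) * (signed s a - signed s' b)
sq-sub≤sq-signed-sub true  true  _ _ = ℚ.≤-refl
sq-sub≤sq-signed-sub false false {a} {b} _ _ = ℚ.≤-reflexive
  (solve 2 (λ a b → (a :- b) :* (a :- b) := (:- a :- :- b) :* (:- a :- :- b)) refl a b)
sq-sub≤sq-signed-sub true  false {a} {b} 0≤a 0≤b = begin
  (a - b) * (a - b)                        ≤⟨ p≤p+q (*-nonNeg (ℕtoℚ-nonNeg 4) (*-nonNeg 0≤a 0≤b)) ⟩
  (a - b) * (a - b) + ℕtoℚ 4 * (a * b)     ≡⟨ solve 2 (λ a b → (a :- b) :* (a :- b) :+ con (ℕtoℚ 4) :* (a :* b) := (a :- :- b) :* (a :- :- b)) refl a b ⟩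
  (a - - b) * (a - - b)                    ∎
  where open ℚ.≤-Reasoning
sq-sub≤sq-signed-sub false true  {a} {b} 0≤a 0≤b = begin
  (a - b) * (a - b)                        ≤⟨ p≤p+q (*-nonNeg (ℕtoℚ-nonNeg 4) (*-nonNeg 0≤a 0≤b)) ⟩
  (a - b) * (a - b) + ℕtoℚ 4 * (a * b)     ≡⟨ solve 2 (λ a b → (a :- b) :* (a :- b) :+ con (ℕtoℚ 4) :* (a :* b) := (:- a :- b) :* (:- a :- b)) refl a b ⟩
  (- a - b) * (- a - b)                    ∎
  where open ℚ.≤-Reasoning

sq≤4*sq-sub : ∀ {x y} → 0ℚ ≤ x → ℕtoℚ 2 * x ≤ y ⊎ ℕtoℚ 2 * y ≤ x →
  x * x ≤ ℕtoℚ 4 * ((x - y) * (x - y))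
sq≤4*sq-sub {x} {y} 0≤x (inj₁ 2x≤y) = begin
  x * x                                   ≤⟨ p≤q⇒p*p≤q*q 0≤x x≤2[y-x] ⟩
  (ℕtoℚ 2 * (y - x)) * (ℕtoℚ 2 * (y - x)) ≡⟨ solve 2 (λ x y → (con (ℕtoℚ 2) :* (y :- x)) :* (con (ℕtoℚ 2) :* (y :- x)) := con (ℕtoℚ 4) :* ((x :- y) :* (x :- y))) refl x y ⟩
  ℕtoℚ 4 * ((x - y) * (x - y))            ∎
  where
  open ℚ.≤-Reasoning
  x≤2[y-x] : x ≤ ℕtoℚ 2 * (y - x)
  x≤2[y-x] = begin
    x                                          ≤⟨ p≤p+q (ℚ.+-mono-≤ (*-nonNeg (ℕtoℚ-nonNeg 2) (p≤q⇒0≤q-p 2x≤y)) 0≤x) ⟩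
    x + (ℕtoℚ 2 * (y - ℕtoℚ 2 * x) + x)        ≡⟨ solve 2 (λ x y → x :+ (con (ℕtoℚ 2) :* (y :- con (ℕtoℚ 2) :* x) :+ x) := con (ℕtoℚ 2) :* (y :- x)) refl x y ⟩
    ℕtoℚ 2 * (y - x)                           ∎
sq≤4*sq-sub {x} {y} 0≤x (inj₂ 2y≤x) = begin
  x * x                                   ≤⟨ p≤q⇒p*p≤q*q 0≤x x≤2[x-y] ⟩
  (ℕtoℚ 2 * (x - y)) * (ℕtoℚ 2 * (x - y)) ≡⟨ solve 2 (λ x y → (con (ℕtoℚ 2) :* (x :- y)) :* (con (ℕtoℚ 2) :* (x :- y)) := con (ℕtoℚ 4) :* ((x :- y) :* (x :- y))) refl x y ⟩
  ℕtoℚ 4 * ((x - y) * (x - y))            ∎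
  where
  open ℚ.≤-Reasoning
  x≤2[x-y] : x ≤ ℕtoℚ 2 * (x - y)
  x≤2[x-y] = begin
    x                                ≤⟨ p≤p+q (p≤q⇒0≤q-p 2y≤x) ⟩
    x + (x - ℕtoℚ 2 * y)             ≡⟨ solve 2 (λ x y → x :+ (x :- con (ℕtoℚ 2) :* y) := con (ℕtoℚ 2) :* (x :- y)) refl x y ⟩
    ℕtoℚ 2 * (x - y)                 ∎

D-mirror : ∀ s x a → D (x , signed s a) (x , signed (not s) a) ≡ ℕtoℚ 4 * (a * a)
D-mirror true  x a = solve 2 (λ x a → (x :- x) :* (x :- x) :+ (a :- :- a) :* (a :- :- a) := con (ℕtoℚ 4) :* (a :* a)) refl x a
D-mirror false x a = solve 2 (λ x a → (x :- x) :* (x :- x) :+ (:- a :- a) :* (:- a :- a) := con (ℕtoℚ 4) :* (a :* a)) refl x a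

clusterPoint : Bool → ℚ → ℚ → Point
clusterPoint s r t = ((ℕtoℚ 2 * t - ℕtoℚ 2) * r , signed s (t * ½ * r))

D-clusterPoint-mirror : ∀ s r t → D (clusterPoint s r t) (clusterPoint (not s) r t) ≡ t * t * (r * r)
D-clusterPoint-mirror s r t = trans (D-mirror s ((ℕtoℚ 2 * t - ℕtoℚ 2) * r) (t * ½ * r))
  (solve 2 (λ r t → con (ℕtoℚ 4) :* ((t :* con ½ :* r) :* (t :* con ½ :* r)) := t :* t :* (r :* r)) refl r t)

-- The x-offset contributes 4 (t − t')² r² and the y-offset at least
-- (t − t')² r² / 4; and 4 (t − t')² ≥ t² as t, t' differ by a factor ≥ 2.
D-clusterPoint-far : ∀ s s' {r t t'} → 0ℚ ≤ r → 0ℚ ≤ t → 0ℚ ≤ t' → ℕtoℚ 2 * t ≤ t' ⊎ ℕtoℚ 2 * t' ≤ t →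
  ℕtoℚ 17 * (t * t * (r * r)) ≤ ℕtoℚ 16 * D (clusterPoint s r t) (clusterPoint s' r t')
D-clusterPoint-far s s' {r} {t} {t'} 0≤r 0≤t 0≤t' separated = begin
  ℕtoℚ 17 * (t * t * (r * r))
    ≤⟨ ℚ.*-monoˡ-≤-nonNeg (ℕtoℚ 17) (ℚ.*-monoʳ-≤-nonNeg (r * r) {{nonNegative (*-nonNeg 0≤r 0≤r)}} (sq≤4*sq-sub 0≤t separated)) ⟩
  ℕtoℚ 17 * (ℕtoℚ 4 * ((t - t') * (t - t')) * (r * r))
    ≡⟨ solve 3 (λ r t t' → con (ℕtoℚ 17) :* (con (ℕtoℚ 4) :* ((t :- t') :* (t :- t')) :* (r :* r))
         := con (ℕtoℚ 16) :* (dx r t t' :* dx r t t' :+ (a r t :- a r t') :* (a r t :- a r t'))) refl r t t' ⟩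
  ℕtoℚ 16 * (Δx * Δx + (t * ½ * r - t' * ½ * r) * (t * ½ * r - t' * ½ * r))
    ≤⟨ ℚ.*-monoˡ-≤-nonNeg (ℕtoℚ 16) (ℚ.+-monoʳ-≤ (Δx * Δx) (sq-sub≤sq-signed-sub s s' (y-nonNeg 0≤t) (y-nonNeg 0≤t'))) ⟩
  ℕtoℚ 16 * D (clusterPoint s r t) (clusterPoint s' r t')  ∎
  where
  open ℚ.≤-Reasoning
  Δx = (ℕtoℚ 2 * t - ℕtoℚ 2) * r - (ℕtoℚ 2 * t' - ℕtoℚ 2) * r
  dx : Polynomial 3 → Polynomial 3 → Polynomial 3 → Polynomial 3
  dx r t t' = (con (ℕtoℚ 2) :* t :- con (ℕtoℚ 2)) :* r :- (con (ℕtoℚ 2) :* t' :- con (ℕtoℚ 2)) :* r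
  a : Polynomial 3 → Polynomial 3 → Polynomial 3
  a r t = t :* con ½ :* r
  y-nonNeg : ∀ {u} → 0ℚ ≤ u → 0ℚ ≤ u * ½ * r
  y-nonNeg 0≤u = *-nonNeg (*-nonNeg 0≤u (ℚ.nonNegative⁻¹ ½)) 0≤r

pt : Bool → ℚ → ℕ → Point
pt true  = pt⁺
pt false = pt⁻

x-coordinate : ∀ j → ℕtoℚ (2 ^ suc j ∸ 2) ≡ ℕtoℚ 2 * ℕtoℚ (2 ^ j) - ℕtoℚ 2
x-coordinate j = trans (ℕtoℚ-∸ (ℕ.*-monoʳ-≤ 2 (ℕ.m^n>0 2 j))) (cong (_- ℕtoℚ 2) (ℕtoℚ-* 2 (2 ^ j)))

y-coordinate : ∀ j → ℤ.+ (2 ^ suc j) / 4 ≡ ℕtoℚ (2 ^ j) * ½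
y-coordinate j = begin
  ℤ.+ (2 ^ suc j) / 4               ≡⟨ ℕtoℚ-/ (2 ^ suc j) 3 ⟩
  ℕtoℚ (2 ^ suc j) * ¼              ≡⟨ cong (_* ¼) (ℕtoℚ-* 2 (2 ^ j)) ⟩
  ℕtoℚ 2 * ℕtoℚ (2 ^ j) * ¼         ≡⟨ solve 1 (λ t → con (ℕtoℚ 2) :* t :* con ¼ := t :* con ½) refl (ℕtoℚ (2 ^ j)) ⟩
  ℕtoℚ (2 ^ j) * ½                  ∎
  where open ≡-Reasoning

pt≡clusterPoint : ∀ s r j → pt s r (suc j) ≡ clusterPoint s r (ℕtoℚ (2 ^ j))
pt≡clusterPoint true  r j = cong₂ (λ x y → (x * r , y * r)) (x-coordinate j) (y-coordinate j)
pt≡clusterPoint false r j = cong₂ (λ x y → (x * r , - (y * r))) (x-coordinate j) (y-coordinate j)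

δ : ℚ → ℕ → ℚ
δ r j = ℕtoℚ (4 ^ j) * (r * r)

δ≡t*t*r*r : ∀ r j → δ r j ≡ ℕtoℚ (2 ^ j) * ℕtoℚ (2 ^ j) * (r * r)
δ≡t*t*r*r r j = cong (_* (r * r)) (trans (cong ℕtoℚ (4^≡2^*2^ j)) (ℕtoℚ-* (2 ^ j) (2 ^ j)))

D-pt-twin : ∀ s r j → D (pt s r (suc j)) (pt (not s) r (suc j)) ≡ δ r j
D-pt-twin s r j = begin
  D (pt s r (suc j)) (pt (not s) r (suc j))           ≡⟨ cong₂ D (pt≡clusterPoint s r j) (pt≡clusterPoint (not s) r j) ⟩
  D (clusterPoint s r t) (clusterPoint (not s) r t)   ≡⟨ D-clusterPoint-mirror s r t ⟩
  t * t * (r * r)                                     ≡⟨ δ≡t*t*r*r r j ⟨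
  δ r j                                               ∎
  where open ≡-Reasoning
        t = ℕtoℚ (2 ^ j)

D-pt-far : ∀ s s' {r j j'} → 0ℚ ≤ r → j ≢ j' →
  ℕtoℚ 17 * δ r j ≤ ℕtoℚ 16 * D (pt s r (suc j)) (pt s' r (suc j'))
D-pt-far s s' {r} {j} {j'} 0≤r j≢j' = begin
  ℕtoℚ 17 * δ r j
    ≡⟨ cong (ℕtoℚ 17 *_) (δ≡t*t*r*r r j) ⟩
  ℕtoℚ 17 * (t * t * (r * r))
    ≤⟨ D-clusterPoint-far s s' 0≤r (ℕtoℚ-nonNeg (2 ^ j)) (ℕtoℚ-nonNeg (2 ^ j')) separated ⟩
  ℕtoℚ 16 * D (clusterPoint s r t) (clusterPoint s' r t')
    ≡⟨ cong (ℕtoℚ 16 *_) (cong₂ D (pt≡clusterPoint s r j) (pt≡clusterPoint s' r j')) ⟨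
  ℕtoℚ 16 * D (pt s r (suc j)) (pt s' r (suc j'))
    ∎
  where
  open ℚ.≤-Reasoning
  t = ℕtoℚ (2 ^ j)
  t' = ℕtoℚ (2 ^ j')
  separated : ℕtoℚ 2 * t ≤ t' ⊎ ℕtoℚ 2 * t' ≤ t
  separated with powers-of-2-separated j≢j'
  ... | inj₁ le = inj₁ (ℚ.≤-trans (ℚ.≤-reflexive (≡.sym (ℕtoℚ-* 2 (2 ^ j)))) (ℕtoℚ-mono-≤ le))
  ... | inj₂ le = inj₂ (ℚ.≤-trans (ℚ.≤-reflexive (≡.sym (ℕtoℚ-* 2 (2 ^ j')))) (ℕtoℚ-mono-≤ le))

δ-pos : ∀ {r} → 0ℚ < r → ∀ j → 0ℚ < δ r j
δ-pos {r} 0<r j = ℚ.positive⁻¹ (δ r j) {{ℚ.pos*pos⇒pos (ℕtoℚ (4 ^ j)) {{4^j-pos}} (r * r) {{ℚ.pos*pos⇒pos r {{positive 0<r}} r {{positive 0<r}}}}}}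
  where
  4^j-pos : Positive (ℕtoℚ (4 ^ j))
  4^j-pos = ℚ.normalize-pos (4 ^ j) 1 {{_}} {{ℕ.m^n≢0 4 j}}

δ≤D-pt : ∀ {r} s s' j j' → 0ℚ ≤ r → (j , s) ≢ (j' , s') → δ r j ≤ D (pt s r (suc j)) (pt s' r (suc j'))
δ≤D-pt {r} s s' j j' 0≤r ne with j ℕ.≟ j'
... | no j≢j' = ℚ.*-cancelˡ-≤-pos (ℕtoℚ 16) (ℚ.≤-trans 16δ≤17δ (D-pt-far s s' 0≤r j≢j'))
  where
  16δ≤17δ : ℕtoℚ 16 * δ r j ≤ ℕtoℚ 17 * δ r j
  16δ≤17δ = ℚ.*-monoʳ-≤-nonNeg (δ r j) {{nonNegative (*-nonNeg (ℕtoℚ-nonNeg (4 ^ j)) (*-nonNeg 0≤r 0≤r))}} (ℕtoℚ-mono-≤ (ℕ.n≤1+n 16))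
... | yes refl = ℚ.≤-reflexive (≡.sym (trans (cong (λ s' → D (pt s r (suc j)) (pt s' r (suc j))) s'≡not-s) (D-pt-twin s r j)))
  where
  s'≡not-s : s' ≡ not s
  s'≡not-s = ¬-not (λ s'≡s → ne (cong (j ,_) (≡.sym s'≡s)))

pt-injective : ∀ {r} s s' j j' → 0ℚ < r → pt s r (suc j) ≡ pt s' r (suc j') → (j , s) ≡ (j' , s')
pt-injective {r} s s' j j' 0<r eq with ≡-dec ℕ._≟_ Bool._≟_ (j , s) (j' , s')
... | yes js≡j's' = js≡j's'
... | no  js≢j's' = ⊥-elim (ℚ.<-irrefl (≡.sym D≡0) (ℚ.<-≤-trans (δ-pos 0<r j) (δ≤D-pt s s' j j' (ℚ.<⇒≤ 0<r) js≢j's')))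
  where
  D≡0 : D (pt s r (suc j)) (pt s' r (suc j')) ≡ 0ℚ
  D≡0 = trans (cong (D (pt s r (suc j))) (≡.sym eq)) (D-self (pt s r (suc j)))

∈-A : ∀ {r m j c} → c ∈ A r m j → ∃[ s ] c ≡ pt s r (suc j)
∈-A {r} {m} {j} c∈A with ∈-++⁻ (replicate (copies m j) (pt⁺ r (suc j))) c∈A
... | inj₁ c∈A⁺ = true  , ∈-replicate⁻ c∈A⁺
... | inj₂ c∈A⁻ = false , ∈-replicate⁻ c∈A⁻

∈-X : ∀ {k r m c} → c ∈ X k r m → ∃[ j ] ∃[ s ] c ≡ pt s r (suc (toℕ j))
∈-X {k} {r} {m} c∈X with satisfied (∈-concatMap⁻ (λ (j : Fin k) → A r m (toℕ j)) {xs = allFin k} c∈X)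
... | j , c∈Aj = j , ∈-A c∈Aj

pt∈A : ∀ s {r m j} → 1 ℕ.≤ copies m j → pt s r (suc j) ∈ A r m j
pt∈A true  {r} {m} {j} 1≤copies = ∈-++⁺ˡ (∈-replicate⁺ 1≤copies)
pt∈A false {r} {m} {j} 1≤copies = ∈-++⁺ʳ (replicate (copies m j) (pt⁺ r (suc j))) (∈-replicate⁺ 1≤copies)

φ-A : ∀ C r m j → φ C (A r m j) ≡ ℕtoℚ (copies m j) * dist (pt true r (suc j)) C + ℕtoℚ (copies m j) * dist (pt false r (suc j)) C
φ-A C r m j = trans (∑-++ (λ y → dist y C) (replicate n (pt⁺ r (suc j))) (replicate n (pt⁻ r (suc j))))
  (cong₂ _+_ (∑-replicate (λ y → dist y C) n (pt⁺ r (suc j))) (∑-replicate (λ y → dist y C) n (pt⁻ r (suc j))))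
  where n = copies m j

φ-X : ∀ C k r m → φ C (X k r m) ≡ ∑ (λ (j : Fin k) → φ C (A r m (toℕ j))) (allFin k)
φ-X C k r m = ∑-concatMap (λ y → dist y C) (λ (j : Fin k) → A r m (toℕ j)) (allFin k)

copies*4^≡m : ∀ {k m} → 4 ^ (k ∸ 1) ∣ m → (j : Fin k) → copies m (toℕ j) ℕ.* 4 ^ toℕ j ≡ m
copies*4^≡m {k} 4^[k-1]∣m j = DivMod.m/n*n≡m {{ℕ.m^n≢0 4 (toℕ j)}}
  (∣.∣-trans (^-monoʳ-∣ 4 (ℕ.∸-monoˡ-≤ 1 (Fin.toℕ<n j))) 4^[k-1]∣m)

copies-pos : ∀ {k m} → m ≥ 1 → 4 ^ (k ∸ 1) ∣ m → (j : Fin k) → 1 ℕ.≤ copies m (toℕ j)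
copies-pos {k} {m} m≥1 4^[k-1]∣m j with copies m (toℕ j) | copies*4^≡m 4^[k-1]∣m j
... | zero  | 0≡m = ⊥-elim (ℕ.<⇒≢ m≥1 0≡m)
... | suc _ | _   = ℕ.s≤s ℕ.z≤n

copies*δ≡M : ∀ {k m} r → 4 ^ (k ∸ 1) ∣ m → (j : Fin k) → ℕtoℚ (copies m (toℕ j)) * δ r (toℕ j) ≡ ℕtoℚ m * (r * r)
copies*δ≡M {k} {m} r 4^[k-1]∣m j = begin
  ℕtoℚ c * (ℕtoℚ (4 ^ J) * (r * r))     ≡⟨ ℚ.*-assoc (ℕtoℚ c) (ℕtoℚ (4 ^ J)) (r * r) ⟨
  ℕtoℚ c * ℕtoℚ (4 ^ J) * (r * r)       ≡⟨ cong (_* (r * r)) (ℕtoℚ-* c (4 ^ J)) ⟨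
  ℕtoℚ (c ℕ.* 4 ^ J) * (r * r)          ≡⟨ cong (λ n → ℕtoℚ n * (r * r)) (copies*4^≡m 4^[k-1]∣m j) ⟩
  ℕtoℚ m * (r * r)                      ∎
  where
  open ≡-Reasoning
  J = toℕ j
  c = copies m J

-- The cost of a seeding

open import Data.List.Membership.DecPropositional _≟P_ using (_∉_; _∈?_)

module SeedingCost {k r m} (0<r : 0ℚ < r) (m≥1 : m ≥ 1) (4^[k-1]∣m : 4 ^ (k ∸ 1) ∣ m)
                   {C : List Point} (C⊆X : ∀ {c} → c ∈ C → c ∈ X k r m) (C≢[] : C ≢ []) where

  M : ℚ
  M = ℕtoℚ m * (r * r)

  M-nonNeg : 0ℚ ≤ M
  M-nonNeg = *-nonNeg (ℕtoℚ-nonNeg m) (0≤p*p r)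

  module _ (s : Bool) (j : Fin k) where
    private
      p = pt s r (suc (toℕ j))
      n = ℕtoℚ (copies m (toℕ j))

    δ≤D : ∀ {c} → c ∈ X k r m → p ≢ c → δ r (toℕ j) ≤ D p c
    δ≤D {c} c∈X p≢c = bound (∈-X {k} {r} {m} c∈X)
      where
      bound : ∃[ j' ] ∃[ s' ] c ≡ pt s' r (suc (toℕ j')) → δ r (toℕ j) ≤ D p c
      bound (j' , s' , c≡p') = ≡.subst (λ c → δ r (toℕ j) ≤ D p c) (≡.sym c≡p')
        (δ≤D-pt s s' (toℕ j) (toℕ j') (ℚ.<⇒≤ 0<r) (λ eq → p≢c (trans (cong (λ (i , b) → pt b r (suc i)) eq) (≡.sym c≡p'))))

    17δ≤16D : ∀ {c} → c ∈ X k r m → (∀ s' → pt s' r (suc (toℕ j)) ≢ c) → ℕtoℚ 17 * δ r (toℕ j) ≤ ℕtoℚ 16 * D p c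
    17δ≤16D {c} c∈X c∉Aj = bound (∈-X {k} {r} {m} c∈X)
      where
      bound : ∃[ j' ] ∃[ s' ] c ≡ pt s' r (suc (toℕ j')) → ℕtoℚ 17 * δ r (toℕ j) ≤ ℕtoℚ 16 * D p c
      bound (j' , s' , c≡p') = ≡.subst (λ c → ℕtoℚ 17 * δ r (toℕ j) ≤ ℕtoℚ 16 * D p c) (≡.sym c≡p')
        (D-pt-far s s' {r} {toℕ j} {toℕ j'} (ℚ.<⇒≤ 0<r) (λ j≡j' → c∉Aj s' (trans (cong (λ i → pt s' r (suc i)) j≡j') (≡.sym c≡p'))))

    missing-point-cost : M * (1ℚ - 𝟙 (p ∈? C)) ≤ n * dist p C
    missing-point-cost = bound (p ∈? C)
      where
      nδ≡M : n * δ r (toℕ j) ≡ M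
      nδ≡M = copies*δ≡M r 4^[k-1]∣m j
      bound : (p∈?C : Dec (p ∈ C)) → M * (1ℚ - 𝟙 p∈?C) ≤ n * dist p C
      bound (yes _)   = ℚ.≤-trans (ℚ.≤-reflexive (ℚ.*-zeroʳ M)) (*-nonNeg (ℕtoℚ-nonNeg (copies m (toℕ j))) (dist-nonNeg p C))
      bound (no  p∉C) = begin
        M * (1ℚ - 0ℚ)        ≡⟨ ℚ.*-identityʳ M ⟩
        M                    ≡⟨ nδ≡M ⟨
        n * δ r (toℕ j)      ≤⟨ ℚ.*-monoˡ-≤-nonNeg n {{nonNegative (ℕtoℚ-nonNeg (copies m (toℕ j)))}} δ≤dist ⟩
        n * dist p C         ∎
        where
        open ℚ.≤-Reasoning
        δ≤dist : δ r (toℕ j) ≤ dist p C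
        δ≤dist = dist-elim (δ r (toℕ j) ≤_) p C C≢[] (λ c∈C → δ≤D (C⊆X c∈C) (λ p≡c → p∉C (≡.subst (_∈ C) (≡.sym p≡c) c∈C)))

    uncovered-point-cost : (∀ s' → pt s' r (suc (toℕ j)) ∉ C) → ℕtoℚ 17 * M ≤ ℕtoℚ 16 * (n * dist p C)
    uncovered-point-cost Aj∩C≡∅ = begin
      ℕtoℚ 17 * M                    ≡⟨ cong (ℕtoℚ 17 *_) (copies*δ≡M r 4^[k-1]∣m j) ⟨
      ℕtoℚ 17 * (n * δ r (toℕ j))    ≡⟨ solve 2 (λ n δ → con (ℕtoℚ 17) :* (n :* δ) := n :* (con (ℕtoℚ 17) :* δ)) refl n (δ r (toℕ j)) ⟩
      n * (ℕtoℚ 17 * δ r (toℕ j))    ≤⟨ ℚ.*-monoˡ-≤-nonNeg n {{nonNegative (ℕtoℚ-nonNeg (copies m (toℕ j)))}} 17δ≤16dist ⟩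
      n * (ℕtoℚ 16 * dist p C)       ≡⟨ solve 2 (λ n d → n :* (con (ℕtoℚ 16) :* d) := con (ℕtoℚ 16) :* (n :* d)) refl n (dist p C) ⟩
      ℕtoℚ 16 * (n * dist p C)       ∎
      where
      open ℚ.≤-Reasoning
      17δ≤16dist : ℕtoℚ 17 * δ r (toℕ j) ≤ ℕtoℚ 16 * dist p C
      17δ≤16dist = dist-elim (λ d → ℕtoℚ 17 * δ r (toℕ j) ≤ ℕtoℚ 16 * d) p C C≢[]
        (λ c∈C → 17δ≤16D (C⊆X c∈C) (λ s' p'≡c → Aj∩C≡∅ s' (≡.subst (_∈ C) (≡.sym p'≡c) c∈C)))

  chosenPoints : Fin k → ℚ
  chosenPoints j = ∑ (λ s → 𝟙 (pt s r (suc (toℕ j)) ∈? C)) (true ∷ false ∷ [])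

  chosenPoints-nonNeg : ∀ j → 0ℚ ≤ chosenPoints j
  chosenPoints-nonNeg j = ∑-nonNeg (λ s → 𝟙-nonNeg (pt s r (suc (toℕ j)) ∈? C)) (true ∷ false ∷ [])

  module _ (j : Fin k) where
    private
      J = toℕ j
      n = ℕtoℚ (copies m J)
      d : Bool → ℚ
      d s = dist (pt s r (suc J)) C
      a : Bool → ℚ
      a s = 𝟙 (pt s r (suc J) ∈? C)
      φ-Aj : φ C (A r m J) ≡ n * d true + n * d false
      φ-Aj = φ-A C r m J

    covered-cluster-cost : ℕtoℚ 17 * M ≤ ℕtoℚ 8 * φ C (A r m J) + M * (ℕtoℚ 8 * chosenPoints j + 1ℚ)
    covered-cluster-cost = begin
      ℕtoℚ 17 * M
        ≡⟨ solve 3 (λ M a⁺ a⁻ → con (ℕtoℚ 17) :* M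
             := con (ℕtoℚ 8) :* (M :* (con 1ℚ :- a⁺) :+ M :* (con 1ℚ :- a⁻)) :+ M :* (con (ℕtoℚ 8) :* (a⁺ :+ (a⁻ :+ con 0ℚ)) :+ con 1ℚ))
             refl M (a true) (a false) ⟩
      ℕtoℚ 8 * (M * (1ℚ - a true) + M * (1ℚ - a false)) + M * (ℕtoℚ 8 * chosenPoints j + 1ℚ)
        ≤⟨ ℚ.+-monoˡ-≤ (M * (ℕtoℚ 8 * chosenPoints j + 1ℚ))
             (ℚ.*-monoˡ-≤-nonNeg (ℕtoℚ 8) (ℚ.+-mono-≤ (missing-point-cost true j) (missing-point-cost false j))) ⟩
      ℕtoℚ 8 * (n * d true + n * d false) + M * (ℕtoℚ 8 * chosenPoints j + 1ℚ)
        ≡⟨ cong (λ φj → ℕtoℚ 8 * φj + M * (ℕtoℚ 8 * chosenPoints j + 1ℚ)) φ-Aj ⟨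
      ℕtoℚ 8 * φ C (A r m J) + M * (ℕtoℚ 8 * chosenPoints j + 1ℚ)
        ∎
      where open ℚ.≤-Reasoning

    uncovered-cluster-cost : ¬ Any (_∈ A r m J) C → ℕtoℚ 17 * M ≤ ℕtoℚ 8 * φ C (A r m J)
    uncovered-cluster-cost ¬covered = ℚ.*-cancelˡ-≤-pos (ℕtoℚ 2) (begin
      ℕtoℚ 2 * (ℕtoℚ 17 * M)
        ≡⟨ solve 1 (λ M → con (ℕtoℚ 2) :* (con (ℕtoℚ 17) :* M) := con (ℕtoℚ 17) :* M :+ con (ℕtoℚ 17) :* M) refl M ⟩
      ℕtoℚ 17 * M + ℕtoℚ 17 * M
        ≤⟨ ℚ.+-mono-≤ (uncovered-point-cost true j Aj∩C≡∅) (uncovered-point-cost false j Aj∩C≡∅) ⟩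
      ℕtoℚ 16 * (n * d true) + ℕtoℚ 16 * (n * d false)
        ≡⟨ solve 2 (λ x y → con (ℕtoℚ 16) :* x :+ con (ℕtoℚ 16) :* y := con (ℕtoℚ 2) :* (con (ℕtoℚ 8) :* (x :+ y))) refl (n * d true) (n * d false) ⟩
      ℕtoℚ 2 * (ℕtoℚ 8 * (n * d true + n * d false))
        ≡⟨ cong (λ φj → ℕtoℚ 2 * (ℕtoℚ 8 * φj)) φ-Aj ⟨
      ℕtoℚ 2 * (ℕtoℚ 8 * φ C (A r m J))
        ∎)
      where
      open ℚ.≤-Reasoning
      Aj∩C≡∅ : ∀ s → pt s r (suc J) ∉ C
      Aj∩C≡∅ s p∈C = ¬covered (lose p∈C (pt∈A s (copies-pos m≥1 4^[k-1]∣m j)))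

  cluster-cost : ∀ j → ℕtoℚ 17 * M ≤ ℕtoℚ 8 * φ C (A r m (toℕ j)) + M * (ℕtoℚ 8 * chosenPoints j + 𝟙 (covers? C (A r m (toℕ j))))
  cluster-cost j = bound (covers? C (A r m (toℕ j)))
    where
    bound : (covered? : Dec (Any (_∈ A r m (toℕ j)) C)) →
      ℕtoℚ 17 * M ≤ ℕtoℚ 8 * φ C (A r m (toℕ j)) + M * (ℕtoℚ 8 * chosenPoints j + 𝟙 covered?)
    bound (yes _)       = covered-cluster-cost j
    bound (no ¬covered) = ℚ.≤-trans (uncovered-cluster-cost j ¬covered) (p≤p+q (*-nonNeg M-nonNeg 0≤8b+0))
      where
      0≤8b+0 : 0ℚ ≤ ℕtoℚ 8 * chosenPoints j + 0ℚ
      0≤8b+0 = ≡.subst (0ℚ ≤_) (≡.sym (ℚ.+-identityʳ _)) (*-nonNeg (ℕtoℚ-nonNeg 8) (chosenPoints-nonNeg j))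

  ∑chosenPoints≤|C| : ∑ chosenPoints (allFin k) ≤ ℕtoℚ (length C)
  ∑chosenPoints≤|C| = ℚ.≤-trans (ℚ.≤-reflexive (≡.sym (∑-cartesianProductWith (λ x → 𝟙 (x ∈? C)) location (allFin k) (true ∷ false ∷ []))))
                          (∑𝟙∈≤length _≟P_ (cartesianProductWith location (allFin k) (true ∷ false ∷ [])) unique C)
    where
    location : Fin k → Bool → Point
    location j s = pt s r (suc (toℕ j))
    unique : Unique (cartesianProductWith location (allFin k) (true ∷ false ∷ []))
    unique = Unique.cartesianProductWith⁺ location
      (λ {j} {j'} {s} {s'} eq → let js≡j's' = pt-injective s s' (toℕ j) (toℕ j') 0<r eq in Fin.toℕ-injective (cong proj₁ js≡j's') , cong proj₂ js≡j's')
      (Unique.allFin⁺ k) (((λ ()) ∷ []) ∷ [] ∷ [])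

  seeding-cost : length C ≡ k → (ℕtoℚ 9 * ℕtoℚ k - ℕtoℚ (numCovered k r m C)) * M ≤ ℕtoℚ 8 * φ C (X k r m)
  seeding-cost |C|≡k = +-cancelʳ-≤ (M * (ℕtoℚ 8 * K + Cov)) (begin
    (ℕtoℚ 9 * K - Cov) * M + M * (ℕtoℚ 8 * K + Cov)
      ≡⟨ solve 3 (λ K Cov M → (con (ℕtoℚ 9) :* K :- Cov) :* M :+ M :* (con (ℕtoℚ 8) :* K :+ Cov) := K :* (con (ℕtoℚ 17) :* M)) refl K Cov M ⟩
    K * (ℕtoℚ 17 * M)
      ≡⟨ ∑-allFin-const k (ℕtoℚ 17 * M) ⟨
    ∑ (λ _ → ℕtoℚ 17 * M) (allFin k)
      ≤⟨ ∑-mono-≤ cluster-cost (allFin k) ⟩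
    ∑ (λ j → ℕtoℚ 8 * φ C (A r m (toℕ j)) + M * (ℕtoℚ 8 * chosenPoints j + cov j)) (allFin k)
      ≡⟨ ∑-linear ⟩
    ℕtoℚ 8 * φ C (X k r m) + M * (ℕtoℚ 8 * ∑ chosenPoints (allFin k) + Cov)
      ≤⟨ ℚ.+-monoʳ-≤ (ℕtoℚ 8 * φ C (X k r m)) (ℚ.*-monoˡ-≤-nonNeg M {{nonNegative M-nonNeg}}
           (ℚ.+-monoˡ-≤ Cov (ℚ.*-monoˡ-≤-nonNeg (ℕtoℚ 8) (ℚ.≤-trans ∑chosenPoints≤|C| (ℚ.≤-reflexive (cong ℕtoℚ |C|≡k)))))) ⟩
    ℕtoℚ 8 * φ C (X k r m) + M * (ℕtoℚ 8 * K + Cov) ∎)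
    where
    open ℚ.≤-Reasoning
    K = ℕtoℚ k
    Cov = ℕtoℚ (numCovered k r m C)
    cov : Fin k → ℚ
    cov j = 𝟙 (covers? C (A r m (toℕ j)))
    ∑-linear : ∑ (λ j → ℕtoℚ 8 * φ C (A r m (toℕ j)) + M * (ℕtoℚ 8 * chosenPoints j + cov j)) (allFin k)
             ≡ ℕtoℚ 8 * φ C (X k r m) + M * (ℕtoℚ 8 * ∑ chosenPoints (allFin k) + Cov)
    ∑-linear = begin-equality
      ∑ (λ j → ℕtoℚ 8 * φj j + M * (ℕtoℚ 8 * chosenPoints j + cov j)) (allFin k)
        ≡⟨ ∑-+ (λ j → ℕtoℚ 8 * φj j) (λ j → M * (ℕtoℚ 8 * chosenPoints j + cov j)) (allFin k) ⟩
      ∑ (λ j → ℕtoℚ 8 * φj j) (allFin k) + ∑ (λ j → M * (ℕtoℚ 8 * chosenPoints j + cov j)) (allFin k)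
        ≡⟨ cong₂ _+_ (∑-*ˡ (ℕtoℚ 8) φj (allFin k)) (∑-*ˡ M (λ j → ℕtoℚ 8 * chosenPoints j + cov j) (allFin k)) ⟩
      ℕtoℚ 8 * ∑ φj (allFin k) + M * ∑ (λ j → ℕtoℚ 8 * chosenPoints j + cov j) (allFin k)
        ≡⟨ cong (λ x → ℕtoℚ 8 * ∑ φj (allFin k) + M * x)
             (trans (∑-+ (λ j → ℕtoℚ 8 * chosenPoints j) cov (allFin k)) (cong (_+ ∑ cov (allFin k)) (∑-*ˡ (ℕtoℚ 8) chosenPoints (allFin k)))) ⟩
      ℕtoℚ 8 * ∑ φj (allFin k) + M * (ℕtoℚ 8 * ∑ chosenPoints (allFin k) + ∑ cov (allFin k))
        ≡⟨ cong₂ (λ Φ Cv → ℕtoℚ 8 * Φ + M * (ℕtoℚ 8 * ∑ chosenPoints (allFin k) + Cv))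
             (≡.sym (φ-X C k r m)) (≡.sym (length-filter≡∑𝟙 (λ j → covers? C (A r m (toℕ j))) (allFin k))) ⟩
      ℕtoℚ 8 * φ C (X k r m) + M * (ℕtoℚ 8 * ∑ chosenPoints (allFin k) + Cov) ∎
      where
      φj : Fin k → ℚ
      φj j = φ C (A r m (toℕ j))

-- The optimal cost

upperPoints : ℕ → ℚ → List Point
upperPoints k r = map (λ (j : Fin k) → pt true r (suc (toℕ j))) (allFin k)

module _ {k r m} (0<r : 0ℚ < r) (m≥1 : m ≥ 1) (4^[k-1]∣m : 4 ^ (k ∸ 1) ∣ m) where

  upperPoints-isCenterSet : IsCenterSet k (X k r m) (upperPoints k r)
  upperPoints-isCenterSet =
      Unique.map⁺ (λ {j} {j'} eq → Fin.toℕ-injective (cong proj₁ (pt-injective true true (toℕ j) (toℕ j') 0<r eq))) (Unique.allFin⁺ k)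
    , ⊆X
    , trans (List.length-map (λ (j : Fin k) → pt true r (suc (toℕ j))) (allFin k)) (List.length-tabulate {n = k} id)
    where
    ⊆X : ∀ {c} → c ∈ upperPoints k r → c ∈ X k r m
    ⊆X c∈U with ∈-map⁻ (λ (j : Fin k) → pt true r (suc (toℕ j))) c∈U
    ... | j , _ , c≡p = ≡.subst (_∈ X k r m) (≡.sym c≡p)
      (∈-concatMap⁺ (λ (j : Fin k) → A r m (toℕ j)) {xs = allFin k} (lose (∈-allFin j) (pt∈A true {r} {m} {toℕ j} (copies-pos m≥1 4^[k-1]∣m j))))

  φ-upperPoints : φ (upperPoints k r) (X k r m) ≤ ℕtoℚ k * (ℕtoℚ m * (r * r))
  φ-upperPoints = begin
    φ U (X k r m)                               ≡⟨ φ-X U k r m ⟩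
    ∑ (λ j → φ U (A r m (toℕ j))) (allFin k)    ≤⟨ ∑-mono-≤ cluster-bound (allFin k) ⟩
    ∑ (λ _ → M) (allFin k)                      ≡⟨ ∑-allFin-const k M ⟩
    ℕtoℚ k * M                                  ∎
    where
    open ℚ.≤-Reasoning
    U = upperPoints k r
    M = ℕtoℚ m * (r * r)
    cluster-bound : ∀ j → φ U (A r m (toℕ j)) ≤ M
    cluster-bound j = begin
      φ U (A r m J)                      ≡⟨ φ-A U r m J ⟩
      n * dist p⁺ U + n * dist p⁻ U      ≤⟨ ℚ.+-mono-≤ (n*-mono (dist-≤-D p⁺ U p⁺∈U)) (n*-mono (dist-≤-D p⁻ U p⁺∈U)) ⟩
      n * D p⁺ p⁺ + n * D p⁻ p⁺          ≡⟨ cong₂ (λ x y → n * x + n * y) (D-self p⁺) (D-pt-twin false r J) ⟩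
      n * 0ℚ + n * δ r J                 ≡⟨ trans (cong (_+ n * δ r J) (ℚ.*-zeroʳ n)) (ℚ.+-identityˡ (n * δ r J)) ⟩
      n * δ r J                          ≡⟨ copies*δ≡M r 4^[k-1]∣m j ⟩
      M                                  ∎
      where
      J = toℕ j
      n = ℕtoℚ (copies m J)
      p⁺ = pt true r (suc J)
      p⁻ = pt false r (suc J)
      p⁺∈U : p⁺ ∈ U
      p⁺∈U = ∈-map⁺ (λ (j : Fin k) → pt true r (suc (toℕ j))) (∈-allFin j)
      n*-mono : ∀ {x y} → x ≤ y → n * x ≤ n * y
      n*-mono = ℚ.*-monoˡ-≤-nonNeg n {{nonNegative (ℕtoℚ-nonNeg (copies m J))}}

KMPP-⊆ : ∀ {Y C c} → KMPP Y C → c ∈ C → c ∈ Y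
KMPP-⊆ (first x∈Y)        (here refl) = x∈Y
KMPP-⊆ (next _ x∈Y _)     (here refl) = x∈Y
KMPP-⊆ (next seeding _ _) (there c∈C) = KMPP-⊆ seeding c∈C

ratio-bound : ∀ α K {M cov opt cost} → 0ℚ ≤ M → 0ℚ ≤ opt → 0ℚ ≤ cost →
  opt ≤ K * M → cov ≤ α * K → (ℕtoℚ 9 * K - cov) * M ≤ ℕtoℚ 8 * cost →
  (ℕtoℚ 9 - α) * opt ≤ ℕtoℚ 8 * cost
ratio-bound α K {M} {cov} {opt} {cost} 0≤M 0≤opt 0≤cost opt≤KM cov≤αK [9K-cov]M≤8cost
  with ℚ.≤-total 0ℚ (ℕtoℚ 9 - α)
... | inj₁ 0≤9-α = begin
  (ℕtoℚ 9 - α) * opt            ≤⟨ ℚ.*-monoˡ-≤-nonNeg (ℕtoℚ 9 - α) {{nonNegative 0≤9-α}} opt≤KM ⟩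
  (ℕtoℚ 9 - α) * (K * M)        ≡⟨ solve 3 (λ α K M → (con (ℕtoℚ 9) :- α) :* (K :* M) := (con (ℕtoℚ 9) :* K :- α :* K) :* M) refl α K M ⟩
  (ℕtoℚ 9 * K - α * K) * M      ≤⟨ ℚ.*-monoʳ-≤-nonNeg M {{nonNegative 0≤M}} (ℚ.+-monoʳ-≤ (ℕtoℚ 9 * K) (ℚ.neg-antimono-≤ cov≤αK)) ⟩
  (ℕtoℚ 9 * K - cov) * M        ≤⟨ [9K-cov]M≤8cost ⟩
  ℕtoℚ 8 * cost                 ∎
  where open ℚ.≤-Reasoning
... | inj₂ 9-α≤0 = ℚ.≤-trans
  (ℚ.nonPositive⁻¹ _ {{ℚ.nonPos*nonNeg⇒nonPos (ℕtoℚ 9 - α) {{nonPositive 9-α≤0}} opt {{nonNegative 0≤opt}}}})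
  (*-nonNeg (ℕtoℚ-nonNeg 8) 0≤cost)

lemma3 : (k : ℕ) → k ≥ 1 → (r : ℚ) → 0ℚ < r → (m : ℕ) → m ≥ 1 → 4 ^ (k ∸ 1) ∣ m →
    (α : ℚ) → (C : List Point) → KMPP (X k r m) C → length C ≡ k →
    (opt : ℚ) → IsOPT k (X k r m) opt →
    ℕtoℚ (numCovered k r m C) ≤ α * ℕtoℚ k →
    (ℕtoℚ 9 - α) * opt ≤ ℕtoℚ 8 * φ C (X k r m)
lemma3 k k≥1 r 0<r m m≥1 4^[k-1]∣m α C seeding |C|≡k opt ((C* , _ , φ≡opt) , opt-minimal) covered≤αk =
  ratio-bound α (ℕtoℚ k) M-nonNeg 0≤opt (φ-nonNeg C (X k r m)) opt≤kM covered≤αk (seeding-cost |C|≡k)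
  where
  C≢[] : C ≢ []
  C≢[] refl = ℕ.<⇒≢ k≥1 |C|≡k
  open SeedingCost {k} 0<r m≥1 4^[k-1]∣m (KMPP-⊆ seeding) C≢[]
  0≤opt : 0ℚ ≤ opt
  0≤opt = ≡.subst (0ℚ ≤_) φ≡opt (φ-nonNeg C* (X k r m))
  opt≤kM : opt ≤ ℕtoℚ k * M
  opt≤kM = ℚ.≤-trans (opt-minimal (upperPoints k r) (upperPoints-isCenterSet {k} 0<r m≥1 4^[k-1]∣m))
                     (φ-upperPoints {k} 0<r m≥1 4^[k-1]∣m)
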